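{- Let $n\ge 1$. A nonempty subset $D\subseteq S_n$ is a $1$-design in $(S_n,d_S)$ if and only if $\sum_{j=0}^n j f_j=n-1$. In particular, if $D$ consists of $n$ permutations that are pairwise at distance $n$ (so that $f_1=\dots=f_{n-1}=0$ and $f_n=\frac{n-1}{n}$), then $D$ is a $1$-design.
   Context: $S_n$ is the symmetric group on $n$ letters. For $\nu\in S_n$ let $F(\nu)$ be its number of fixed points; the metric is $d_S(\sigma,\theta)=n-F(\sigma\theta^{ -1})$. For $j\in\{0,\dots,n\}$ let $v_j$ be the number of permutations with exactly $n-j$ fixed points. For nonempty $D\subseteq S_n$, its frequencies are $f_i=|\{(x,y)\in D^2: d_S(x,y)=i\}|/|D|^2$, $i=0,\dots,n$. $D$ is a $t$-design if $\sum_{j=0}^n f_j j^i=\sum_{j=0}^n \frac{v_j}{n!} j^i$ for every $i=1,\dots,t$. -}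

module Defs where

open import Data.Nat as ℕ using (ℕ; zero; suc; _∸_; _^_)
open import Data.Fin using (Fin)
open import Data.Fin.Properties using (_≟_; any?; all?)
open import Data.Vec using (Vec; []; _∷_; lookup)
open import Data.List using (List; []; _∷_; [_]; map; concatMap; allFin; filter; length; upTo; foldr)
open import Data.Product using (_×_; _,_; ∃)
open import Data.Nat.Properties using (_!≢0)
import Data.Vec
import Data.List
import Data.Product
open import Data.Integer using (+_)
open import Data.Rational using (ℚ; _/_; _+_; _*_; 0ℚ)
open import Relation.Binary.PropositionalEquality using (_≡_)
open import Relation.Nullary using (Dec; yes; no; _×-dec_; _→-dec_)
open import Relation.Unary using (Decidable)

countD : ∀ {A : Set} {P : A → Set} → Decidable P → List A → ℕ
countD P? xs = length (filter P? xs)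

Map : ℕ → Set
Map n = Vec (Fin n) n

IsPerm : ∀ {n} → Map n → Set
IsPerm {n} σ = (∀ (i j : Fin n) → lookup σ i ≡ lookup σ j → i ≡ j)
             × (∀ (k : Fin n) → ∃ λ i → lookup σ i ≡ k)

isPerm? : ∀ {n} → Decidable (IsPerm {n})
isPerm? σ = all? (λ i → all? (λ j → (lookup σ i ≟ lookup σ j) →-dec (i ≟ j)))
            ×-dec all? (λ k → any? (λ i → lookup σ i ≟ k))

allVecs : ∀ {n} (m : ℕ) → List (Vec (Fin n) m)
allVecs zero = [ [] ]
allVecs {n} (suc m) = concatMap (λ x → map (x ∷_) (allVecs m)) (allFin n)

Sym : ∀ n → List (Map n)
Sym n = filter isPerm? (allVecs n)

-- composition and inverse (inverse found by search; correct on permutations)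
_∘ₘ_ : ∀ {n} → Map n → Map n → Map n
_∘ₘ_ {n} σ θ = Data.Vec.tabulate (λ i → lookup σ (lookup θ i))

inv : ∀ {n} → Map n → Map n
inv {n} θ = Data.Vec.tabulate f
  where
  f : Fin n → Fin n
  f i with any? (λ k → lookup θ k ≟ i)
  ... | yes (k , _) = k
  ... | no _ = i

F : ∀ {n} → Map n → ℕ
F {n} ν = countD (λ i → lookup ν i ≟ i) (allFin n)

dS : ∀ {n} → Map n → Map n → ℕ
dS {n} σ θ = n ∸ F (σ ∘ₘ inv θ)

v : ∀ n → ℕ → ℕ
v n j = countD (λ ν → F ν ℕ.≟ (n ∸ j)) (Sym n)

toℚ : ℕ → ℚ
toℚ m = (+ m) / 1

Σℚ : ℕ → (ℕ → ℚ) → ℚ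
Σℚ n g = foldr (λ j acc → g j + acc) 0ℚ (upTo (suc n))

pairCount : ∀ {n} → List (Map n) → ℕ → ℕ
pairCount D i = countD (λ p → dS (Data.Product.proj₁ p) (Data.Product.proj₂ p) ℕ.≟ i)
                       (Data.List.cartesianProduct D D)

-- frequencies f_i = pairCount/|D|² (D nonempty; the [] case is irrelevant)
freq : ∀ {n} → List (Map n) → ℕ → ℚ
freq [] i = 0ℚ
freq D@(_ ∷ xs) i = (+ pairCount D i) / (suc (length xs) ℕ.* suc (length xs))

IsDesign : ∀ n → ℕ → List (Map n) → Set
IsDesign n t D = ∀ (i : ℕ) → 1 ℕ.≤ i → i ℕ.≤ t →
  Σℚ n (λ j → freq D j * toℚ (j ^ i))
    ≡ Σℚ n (λ j → (_/_ (+ v n j) (n ℕ.!) {{n !≢0}}) * toℚ (j ^ i))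

-- Each of the n points is fixed by exactly (n − 1)! of the n! permutations, so ∑_ν F ν = n!
-- and the mean distance ∑_j j v_j / n! = ∑_ν (n − F ν) / n! is n − 1; being a 1-design means
-- exactly that the mean distance ∑_j j f_j within D is n − 1 as well. Both counts come from
-- enumerating permutations as fresh vectors (entries pairwise distinct), of which there are
-- m! of length m over m available values. For n permutations at pairwise distance n, the
-- n(n − 1) off-diagonal pairs contribute n each and the diagonal nothing, so the mean
-- distance is n · n(n − 1) / n² = n − 1.
module Submission where

open import Data.Bool.Base using (if_then_else_)
open import Data.Empty using (⊥-elim)
open import Data.Fin as Fin using (Fin)
open import Data.Fin.Properties using (_≟_; ¬Fin0; any?; punchOut-injective; suc-injective; <⇒notInjective)
import Data.Integer as ℤ
import Data.Integer.Properties as ℤ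
open import Data.List as List
  using (List; []; _∷_; _++_; map; concatMap; filter; length; allFin; upTo; cartesianProduct; foldr)
import Data.List.Properties as List
open import Data.List.Membership.Propositional using (_∈_; _∉_)
open import Data.List.Membership.Propositional.Properties using (∈-allFin; ∈-upTo⁺; ∈-upTo⁻)
open import Data.List.Relation.Unary.All as All using (All; []; _∷_)
open import Data.List.Relation.Unary.All.Properties using (All¬⇒¬Any; ¬Any⇒All¬)
open import Data.List.Relation.Unary.AllPairs using (AllPairs; []; _∷_)
open import Data.List.Relation.Unary.Any using (here; there)
open import Data.List.Relation.Unary.Unique.Propositional using (Unique)
open import Data.List.Relation.Unary.Unique.Propositional.Properties using (allFin⁺; upTo⁺)
open import Data.Nat as ℕ using (ℕ; zero; suc; _+_; _*_; _∸_; _≤_; _^_; _!; NonZero; s≤s)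
import Data.Nat.Properties as ℕ
open import Algebra.Properties.CommutativeSemigroup ℕ.+-commutativeSemigroup using (interchange)
open import Data.Product using (_×_; _,_; proj₁; proj₂)
open import Data.Rational as ℚ using (ℚ; _/_; 0ℚ)
import Data.Rational.Properties as ℚ
open import Data.Rational.Unnormalised as ℚᵘ using (mkℚᵘ; *≡*)
import Data.Rational.Unnormalised.Properties as ℚᵘ
open import Data.Unit using (⊤; tt)
open import Data.Vec as Vec using (Vec; []; _∷_; lookup)
import Data.Vec.Properties as Vec
open import Function using (_∘_; id)
open import Function.Bundles using (_⇔_; mk⇔; Equivalence)
open import Function.Definitions using (Injective; StrictlySurjective)
open import Relation.Binary.Definitions using (DecidableEquality)
open import Relation.Binary.PropositionalEquality
open import Relation.Nullary using (Dec; yes; no; does; ¬_; ¬?; _×-dec_)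
open import Relation.Unary using (Decidable)

open import Defs

private
  variable
    A B P Q : Set

𝟙 : Dec P → ℕ
𝟙 d = if does d then 1 else 0

𝟙-yes : (d : Dec P) → P → 𝟙 d ≡ 1
𝟙-yes (yes _) _ = refl
𝟙-yes (no ¬p) p = ⊥-elim (¬p p)

𝟙-no : (d : Dec P) → ¬ P → 𝟙 d ≡ 0
𝟙-no (yes p) ¬p = ⊥-elim (¬p p)
𝟙-no (no _)  _  = refl

𝟙-cong : (d : Dec P) (e : Dec Q) → (P → Q) → (Q → P) → 𝟙 d ≡ 𝟙 e
𝟙-cong d (yes q) _ g = 𝟙-yes d (g q)
𝟙-cong d (no ¬q) f _ = 𝟙-no d (¬q ∘ f)

𝟙-× : (d : Dec P) (e : Dec Q) → 𝟙 (d ×-dec e) ≡ 𝟙 d * 𝟙 e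
𝟙-× (yes _) (yes _) = refl
𝟙-× (yes _) (no _)  = refl
𝟙-× (no _)  _       = refl

𝟙-¬ : (d : Dec P) → 𝟙 (¬? d) + 𝟙 d ≡ 1
𝟙-¬ (yes _) = refl
𝟙-¬ (no _)  = refl

𝟙-*-cong : ∀ (d : Dec P) {a b} → (P → a ≡ b) → 𝟙 d * a ≡ 𝟙 d * b
𝟙-*-cong (yes p) eq = cong (1 *_) (eq p)
𝟙-*-cong (no _)  _  = refl

∑ : List A → (A → ℕ) → ℕ
∑ xs f = foldr (λ x s → f x + s) 0 xs

syntax ∑ xs (λ x → e) = ∑[ x ∈ xs ] e

∑-cong : ∀ (xs : List A) {f g : A → ℕ} → (∀ x → f x ≡ g x) → ∑ xs f ≡ ∑ xs g
∑-cong xs eq = List.foldr-cong (λ x s → cong (_+ s) (eq x)) refl xs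

∑-cong-All : ∀ {xs : List A} {f g} → All (λ x → f x ≡ g x) xs → ∑ xs f ≡ ∑ xs g
∑-cong-All []       = refl
∑-cong-All (e ∷ es) = cong₂ _+_ e (∑-cong-All es)

∑-const : ∀ (xs : List A) c → ∑[ _ ∈ xs ] c ≡ length xs * c
∑-const []       c = refl
∑-const (x ∷ xs) c = cong (c +_) (∑-const xs c)

∑-zero : ∀ {xs : List A} {f} → All (λ x → f x ≡ 0) xs → ∑ xs f ≡ 0
∑-zero {xs = xs} es = trans (∑-cong-All es) (trans (∑-const xs 0) (ℕ.*-zeroʳ (length xs)))

∑-+ : ∀ (xs : List A) f g → ∑[ x ∈ xs ] (f x + g x) ≡ ∑ xs f + ∑ xs g
∑-+ []       f g = refl
∑-+ (x ∷ xs) f g = trans (cong (f x + g x +_) (∑-+ xs f g)) (interchange (f x) (g x) _ _)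

∑-*ˡ : ∀ (xs : List A) c f → ∑[ x ∈ xs ] (c * f x) ≡ c * ∑ xs f
∑-*ˡ []       c f = sym (ℕ.*-zeroʳ c)
∑-*ˡ (x ∷ xs) c f = trans (cong (c * f x +_) (∑-*ˡ xs c f)) (sym (ℕ.*-distribˡ-+ c (f x) _))

∑-*ʳ : ∀ (xs : List A) f c → ∑[ x ∈ xs ] (f x * c) ≡ ∑ xs f * c
∑-*ʳ []       f c = refl
∑-*ʳ (x ∷ xs) f c = trans (cong (f x * c +_) (∑-*ʳ xs f c)) (sym (ℕ.*-distribʳ-+ c (f x) _))

∑-∸ : ∀ (xs : List A) c f → (∀ x → f x ≤ c) → ∑[ x ∈ xs ] (c ∸ f x) + ∑ xs f ≡ length xs * c
∑-∸ xs c f f≤c = trans (sym (∑-+ xs _ f)) (trans (∑-cong xs (λ x → ℕ.m∸n+n≡m (f≤c x))) (∑-const xs c))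

∑-++ : ∀ (xs ys : List A) f → ∑ (xs ++ ys) f ≡ ∑ xs f + ∑ ys f
∑-++ []       ys f = refl
∑-++ (x ∷ xs) ys f = trans (cong (f x +_) (∑-++ xs ys f)) (sym (ℕ.+-assoc (f x) _ _))

∑-map : ∀ (h : A → B) (xs : List A) f → ∑ (map h xs) f ≡ ∑ xs (f ∘ h)
∑-map h []       f = refl
∑-map h (x ∷ xs) f = cong (f (h x) +_) (∑-map h xs f)

∑-concatMap : ∀ (h : A → List B) (xs : List A) f → ∑ (concatMap h xs) f ≡ ∑[ x ∈ xs ] ∑ (h x) f
∑-concatMap h []       f = refl
∑-concatMap h (x ∷ xs) f = trans (∑-++ (h x) _ f) (cong (∑ (h x) f +_) (∑-concatMap h xs f))

∑-comm : ∀ (xs : List A) (ys : List B) (f : A → B → ℕ) →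
         ∑[ x ∈ xs ] ∑[ y ∈ ys ] f x y ≡ ∑[ y ∈ ys ] ∑[ x ∈ xs ] f x y
∑-comm []       ys f = sym (trans (∑-const ys 0) (ℕ.*-zeroʳ (length ys)))
∑-comm (x ∷ xs) ys f =
  trans (cong (∑ ys (f x) +_) (∑-comm xs ys f)) (sym (∑-+ ys (f x) (λ y → ∑[ x ∈ xs ] f x y)))

∑-cartesianProduct : ∀ (xs : List A) (ys : List B) (f : A × B → ℕ) →
                     ∑ (cartesianProduct xs ys) f ≡ ∑[ x ∈ xs ] ∑[ y ∈ ys ] f (x , y)
∑-cartesianProduct []       ys f = refl
∑-cartesianProduct (x ∷ xs) ys f =
  trans (∑-++ (map (x ,_) ys) _ f) (cong₂ _+_ (∑-map (x ,_) ys f) (∑-cartesianProduct xs ys f))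

∑-filter : ∀ {P : A → Set} (P? : Decidable P) xs f → ∑ (filter P? xs) f ≡ ∑[ x ∈ xs ] (𝟙 (P? x) * f x)
∑-filter P? []       f = refl
∑-filter P? (x ∷ xs) f with P? x
... | yes _ = cong₂ _+_ (sym (ℕ.+-identityʳ (f x))) (∑-filter P? xs f)
... | no  _ = ∑-filter P? xs f

countD≡∑𝟙 : ∀ {P : A → Set} (P? : Decidable P) xs → countD P? xs ≡ ∑[ x ∈ xs ] 𝟙 (P? x)
countD≡∑𝟙 P? []       = refl
countD≡∑𝟙 P? (x ∷ xs) with P? x
... | yes _ = cong suc (countD≡∑𝟙 P? xs)
... | no  _ = countD≡∑𝟙 P? xs

-- Stated without subtraction: the right-hand side counts the diagonal as if d were c there too.
∑∑-const-off-diagonal : ∀ {A : Set} (d : A → A → ℕ) c (xs : List A) → All (λ x → d x x ≡ 0) xs →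
                        AllPairs (λ x y → d x y ≡ c × d y x ≡ c) xs →
                        ∑[ x ∈ xs ] ∑[ y ∈ xs ] d x y + length xs * c ≡ length xs * length xs * c
∑∑-const-off-diagonal d c []       _            _            = refl
∑∑-const-off-diagonal {A} d c (x ∷ xs) (dxx ∷ diag) (row ∷ rest) = begin
  (d x x + ∑ xs (d x)) + ∑[ y ∈ xs ] (d y x + ∑ xs (d y)) + (c + m * c)
    ≡⟨ cong (_+ (c + m * c)) (cong₂ _+_ (cong₂ _+_ dxx (line proj₁)) (∑-+ xs (λ y → d y x) _)) ⟩
  (0 + m * c) + (∑[ y ∈ xs ] d y x + T) + (c + m * c)
    ≡⟨ cong (λ t → (0 + m * c) + (t + T) + (c + m * c)) (line proj₂) ⟩
  (0 + m * c) + (m * c + T) + (c + m * c)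
    ≡⟨ solve 3 (λ m c T → (con 0 :+ m :* c) :+ (m :* c :+ T) :+ (c :+ m :* c)
                          := (T :+ m :* c) :+ (c :+ m :* c :+ m :* c)) refl m c T ⟩
  (T + m * c) + (c + m * c + m * c)
    ≡⟨ cong (_+ (c + m * c + m * c)) (∑∑-const-off-diagonal d c xs diag rest) ⟩
  m * m * c + (c + m * c + m * c)
    ≡⟨ solve 2 (λ m c → m :* m :* c :+ (c :+ m :* c :+ m :* c) := (con 1 :+ m) :* (con 1 :+ m) :* c) refl m c ⟩
  suc m * suc m * c ∎
  where
  open ≡-Reasoning
  open import Data.Nat.Solver using (module +-*-Solver)
  open +-*-Solver
  m T : ℕ
  m = length xs
  T = ∑[ y ∈ xs ] ∑ xs (d y)
  line : ∀ {f : A → ℕ} → (∀ {y} → d x y ≡ c × d y x ≡ c → f y ≡ c) → ∑ xs f ≡ m * c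
  line pick = trans (∑-cong-All (All.map pick row)) (∑-const xs c)

module Counting {A : Set} (_≟ᴬ_ : DecidableEquality A) where

  open import Data.List.Membership.DecPropositional _≟ᴬ_ using (_∈?_; _∉?_)

  ∑-pick : ∀ {xs c} → Unique xs → c ∈ xs → ∀ (h : A → ℕ) → ∑[ x ∈ xs ] (𝟙 (x ≟ᴬ c) * h x) ≡ h c
  ∑-pick {c ∷ xs} (c∉xs ∷ _) (here refl) h = begin
    𝟙 (c ≟ᴬ c) * h c + ∑[ x ∈ xs ] (𝟙 (x ≟ᴬ c) * h x) ≡⟨ cong₂ _+_ (cong (_* h c) (𝟙-yes (c ≟ᴬ c) refl)) rest ⟩
    1 * h c + 0                                       ≡⟨ ℕ.+-identityʳ _ ⟩
    1 * h c                                           ≡⟨ ℕ.*-identityˡ (h c) ⟩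
    h c                                               ∎
    where
    open ≡-Reasoning
    rest : ∑[ x ∈ xs ] (𝟙 (x ≟ᴬ c) * h x) ≡ 0
    rest = ∑-zero (All.map (λ c≢x → cong (_* h _) (𝟙-no (_ ≟ᴬ c) (c≢x ∘ sym))) c∉xs)
  ∑-pick {y ∷ xs} {c} (y∉xs ∷ u) (there c∈xs) h =
    trans (cong (λ k → k * h y + ∑[ x ∈ xs ] (𝟙 (x ≟ᴬ c) * h x)) (𝟙-no (y ≟ᴬ c) (All.lookup y∉xs c∈xs)))
          (∑-pick u c∈xs h)

  𝟙-∈-∷ : ∀ {x b B} → b ∉ B → 𝟙 (x ∈? b ∷ B) ≡ 𝟙 (x ≟ᴬ b) + 𝟙 (x ∈? B)
  𝟙-∈-∷ {x} {b} {B} b∉B with x ≟ᴬ b | x ∈? B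
  ... | yes refl | yes x∈B = ⊥-elim (b∉B x∈B)
  ... | yes _    | no _    = refl
  ... | no _     | _       = refl

  ∑-𝟙-≟ : ∀ {xs c} → Unique xs → c ∈ xs → ∑[ x ∈ xs ] 𝟙 (x ≟ᴬ c) ≡ 1
  ∑-𝟙-≟ {xs} {c} u c∈xs =
    trans (∑-cong xs (λ x → sym (ℕ.*-identityʳ (𝟙 (x ≟ᴬ c))))) (∑-pick u c∈xs (λ _ → 1))

  ∑-𝟙-∈ : ∀ {xs B} → Unique xs → Unique B → All (_∈ xs) B → ∑[ x ∈ xs ] 𝟙 (x ∈? B) ≡ length B
  ∑-𝟙-∈ {xs} {[]}    _ _          _             = trans (∑-const xs 0) (ℕ.*-zeroʳ (length xs))
  ∑-𝟙-∈ {xs} {b ∷ B} u (b∉B ∷ uB) (b∈xs ∷ B⊆xs) = begin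
    ∑[ x ∈ xs ] 𝟙 (x ∈? b ∷ B)                       ≡⟨ ∑-cong xs (λ x → 𝟙-∈-∷ (All¬⇒¬Any b∉B)) ⟩
    ∑[ x ∈ xs ] (𝟙 (x ≟ᴬ b) + 𝟙 (x ∈? B))            ≡⟨ ∑-+ xs _ _ ⟩
    ∑[ x ∈ xs ] 𝟙 (x ≟ᴬ b) + ∑[ x ∈ xs ] 𝟙 (x ∈? B) ≡⟨ cong₂ _+_ (∑-𝟙-≟ u b∈xs) (∑-𝟙-∈ u uB B⊆xs) ⟩
    suc (length B)                                   ∎
    where open ≡-Reasoning

  ∑-𝟙-∉ : ∀ {xs B} → Unique xs → Unique B → All (_∈ xs) B → ∑[ x ∈ xs ] 𝟙 (x ∉? B) + length B ≡ length xs
  ∑-𝟙-∉ {xs} {B} u uB B⊆xs = begin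
    ∑[ x ∈ xs ] 𝟙 (x ∉? B) + length B               ≡⟨ cong (∑[ x ∈ xs ] 𝟙 (x ∉? B) +_) (∑-𝟙-∈ u uB B⊆xs) ⟨
    ∑[ x ∈ xs ] 𝟙 (x ∉? B) + ∑[ x ∈ xs ] 𝟙 (x ∈? B) ≡⟨ ∑-+ xs _ _ ⟨
    ∑[ x ∈ xs ] (𝟙 (x ∉? B) + 𝟙 (x ∈? B))           ≡⟨ ∑-cong xs (λ x → 𝟙-¬ (x ∈? B)) ⟩
    ∑[ _ ∈ xs ] 1                                   ≡⟨ ∑-const xs 1 ⟩
    length xs * 1                                   ≡⟨ ℕ.*-identityʳ _ ⟩
    length xs                                       ∎
    where open ≡-Reasoning

∑-by-value : ∀ n (xs : List A) (f : A → ℕ) → (∀ x → f x ≤ n) →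
             ∑[ j ∈ upTo (suc n) ] (countD (λ x → f x ℕ.≟ j) xs * j) ≡ ∑ xs f
∑-by-value n xs f f≤n = begin
  ∑[ j ∈ js ] (countD (λ x → f x ℕ.≟ j) xs * j) ≡⟨ ∑-cong js (λ j → cong (_* j) (countD≡∑𝟙 _ xs)) ⟩
  ∑[ j ∈ js ] (∑[ x ∈ xs ] 𝟙 (f x ℕ.≟ j) * j)   ≡⟨ ∑-cong js (λ j → ∑-*ʳ xs _ j) ⟨
  ∑[ j ∈ js ] ∑[ x ∈ xs ] (𝟙 (f x ℕ.≟ j) * j)   ≡⟨ ∑-comm js xs _ ⟩
  ∑[ x ∈ xs ] ∑[ j ∈ js ] (𝟙 (f x ℕ.≟ j) * j)   ≡⟨ ∑-cong xs (λ x → ∑-cong js (λ j → cong (_* j) (𝟙-≟-sym x j))) ⟩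
  ∑[ x ∈ xs ] ∑[ j ∈ js ] (𝟙 (j ℕ.≟ f x) * j)   ≡⟨ ∑-cong xs (λ x → ∑-pick (upTo⁺ (suc n)) (∈-upTo⁺ (s≤s (f≤n x))) id) ⟩
  ∑[ x ∈ xs ] f x                               ∎
  where
  open ≡-Reasoning
  open Counting ℕ._≟_ using (∑-pick)
  js : List ℕ
  js = upTo (suc n)
  𝟙-≟-sym : ∀ x j → 𝟙 (f x ℕ.≟ j) ≡ 𝟙 (j ℕ.≟ f x)
  𝟙-≟-sym x j = 𝟙-cong (f x ℕ.≟ j) (j ℕ.≟ f x) sym sym

length-allFin : ∀ n → length (allFin n) ≡ n
length-allFin n = List.length-tabulate id

module _ {n : ℕ} where

  open Counting (_≟_ {n})
  open import Data.List.Membership.DecPropositional (_≟_ {n}) using (_∈?_; _∉?_)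

  private
    variable
      m : ℕ
      x c : Fin n
      S : List (Fin n)

  Fresh : List (Fin n) → Vec (Fin n) m → Set
  Fresh S []      = ⊤
  Fresh S (x ∷ r) = x ∉ S × Fresh (x ∷ S) r

  fresh? : (S : List (Fin n)) (r : Vec (Fin n) m) → Dec (Fresh S r)
  fresh? S []      = yes tt
  fresh? S (x ∷ r) = x ∉? S ×-dec fresh? (x ∷ S) r

  Fresh⇒avoiding×injective : (r : Vec (Fin n) m) → Fresh S r →
                             (∀ i → lookup r i ∉ S) × Injective _≡_ _≡_ (lookup r)
  Fresh⇒avoiding×injective []      _             = (λ ()) , λ {i} → ⊥-elim (¬Fin0 i)
  Fresh⇒avoiding×injective {S = S} (x ∷ r) (x∉S , fresh) = avoiding , injective
    where
    rest : (∀ i → lookup r i ∉ x ∷ S) × Injective _≡_ _≡_ (lookup r)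
    rest = Fresh⇒avoiding×injective r fresh
    avoiding : ∀ i → lookup (x ∷ r) i ∉ S
    avoiding Fin.zero    = x∉S
    avoiding (Fin.suc i) = proj₁ rest i ∘ there
    injective : Injective _≡_ _≡_ (lookup (x ∷ r))
    injective {Fin.zero}  {Fin.zero}  _  = refl
    injective {Fin.zero}  {Fin.suc j} eq = ⊥-elim (proj₁ rest j (here (sym eq)))
    injective {Fin.suc i} {Fin.zero}  eq = ⊥-elim (proj₁ rest i (here eq))
    injective {Fin.suc i} {Fin.suc j} eq = cong Fin.suc (proj₂ rest eq)

  avoiding×injective⇒Fresh : (r : Vec (Fin n) m) → (∀ i → lookup r i ∉ S) → Injective _≡_ _≡_ (lookup r) →
                             Fresh S r
  avoiding×injective⇒Fresh []      _        _         = tt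
  avoiding×injective⇒Fresh (x ∷ r) avoiding injective =
    avoiding Fin.zero , avoiding×injective⇒Fresh r avoiding′ (suc-injective ∘ injective)
    where
    avoiding′ : ∀ i → lookup r i ∉ x ∷ _
    avoiding′ i (here eq)  with () ← injective {Fin.suc i} {Fin.zero} eq
    avoiding′ i (there r∈) = avoiding (Fin.suc i) r∈

  unique-∷ : x ∉ S → Unique S → Unique (x ∷ S)
  unique-∷ {S = S} x∉S u = ¬Any⇒All¬ S x∉S ∷ u

  length-∷-+ : ∀ (S : List (Fin n)) m → length S + suc m ≡ n → suc (length S) + m ≡ n
  length-∷-+ S m len = trans (sym (ℕ.+-suc (length S) m)) len

  ∑-∉-allFin : Unique S → length S + m ≡ n → ∑[ x ∈ allFin n ] 𝟙 (x ∉? S) ≡ m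
  ∑-∉-allFin {S} {m} u len = ℕ.+-cancelʳ-≡ _ _ _ (begin
    ∑[ x ∈ allFin n ] 𝟙 (x ∉? S) + length S ≡⟨ ∑-𝟙-∉ (allFin⁺ n) u (All.tabulate λ {x} _ → ∈-allFin x) ⟩
    length (allFin n)                       ≡⟨ length-allFin n ⟩
    n                                       ≡⟨ trans (ℕ.+-comm m (length S)) len ⟨
    m + length S                            ∎)
    where open ≡-Reasoning

  ∉-∷-swap : x ∉ S × c ∉ x ∷ S → c ∉ S × x ∉ c ∷ S
  ∉-∷-swap (x∉S , c∉x∷S) = c∉x∷S ∘ there , λ { (here refl) → c∉x∷S (here refl) ; (there x∈S) → x∉S x∈S }

  𝟙-∉-∷-swap : ∀ x c S → 𝟙 (x ∉? S) * 𝟙 (c ∉? x ∷ S) ≡ 𝟙 (c ∉? S) * 𝟙 (x ∉? c ∷ S)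
  𝟙-∉-∷-swap x c S = begin
    𝟙 (x ∉? S) * 𝟙 (c ∉? x ∷ S) ≡⟨ 𝟙-× (x ∉? S) (c ∉? x ∷ S) ⟨
    𝟙 (x ∉? S ×-dec c ∉? x ∷ S) ≡⟨ 𝟙-cong (x ∉? S ×-dec c ∉? x ∷ S) (c ∉? S ×-dec x ∉? c ∷ S) ∉-∷-swap ∉-∷-swap ⟩
    𝟙 (c ∉? S ×-dec x ∉? c ∷ S) ≡⟨ 𝟙-× (c ∉? S) (x ∉? c ∷ S) ⟩
    𝟙 (c ∉? S) * 𝟙 (x ∉? c ∷ S) ∎
    where open ≡-Reasoning

  ∑-allVecs-suc : ∀ m (g : Vec (Fin n) (suc m) → ℕ) →
                  ∑ (allVecs (suc m)) g ≡ ∑[ x ∈ allFin n ] ∑[ r ∈ allVecs m ] g (x ∷ r)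
  ∑-allVecs-suc m g = trans (∑-concatMap (λ x → map (x ∷_) (allVecs m)) (allFin n) g)
                            (∑-cong (allFin n) (λ x → ∑-map (x ∷_) (allVecs m) g))

  ∑-fresh-∷ : ∀ m S (g : Vec (Fin n) (suc m) → ℕ) →
    ∑[ r ∈ allVecs (suc m) ] (𝟙 (fresh? S r) * g r)
      ≡ ∑[ x ∈ allFin n ] (𝟙 (x ∉? S) * ∑[ r ∈ allVecs m ] (𝟙 (fresh? (x ∷ S) r) * g (x ∷ r)))
  ∑-fresh-∷ m S g = trans (∑-allVecs-suc m (λ r → 𝟙 (fresh? S r) * g r)) (∑-cong (allFin n) λ x → begin
    ∑[ r ∈ allVecs m ] (𝟙 (x ∉? S ×-dec fresh? (x ∷ S) r) * g (x ∷ r))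
      ≡⟨ ∑-cong (allVecs m) (λ r → trans (cong (_* g (x ∷ r)) (𝟙-× (x ∉? S) (fresh? (x ∷ S) r)))
                                         (ℕ.*-assoc (𝟙 (x ∉? S)) _ _)) ⟩
    ∑[ r ∈ allVecs m ] (𝟙 (x ∉? S) * (𝟙 (fresh? (x ∷ S) r) * g (x ∷ r)))
      ≡⟨ ∑-*ˡ (allVecs m) (𝟙 (x ∉? S)) _ ⟩
    𝟙 (x ∉? S) * ∑[ r ∈ allVecs m ] (𝟙 (fresh? (x ∷ S) r) * g (x ∷ r)) ∎)
    where open ≡-Reasoning

  count-fresh : ∀ m → Unique S → length S + m ≡ n → ∑[ r ∈ allVecs m ] 𝟙 (fresh? S r) ≡ m !
  count-fresh zero    _ _ = refl
  count-fresh {S} (suc m) u len = begin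
    ∑[ r ∈ allVecs (suc m) ] 𝟙 (fresh? S r)
      ≡⟨ ∑-cong (allVecs (suc m)) (λ r → ℕ.*-identityʳ (𝟙 (fresh? S r))) ⟨
    ∑[ r ∈ allVecs (suc m) ] (𝟙 (fresh? S r) * 1)
      ≡⟨ ∑-fresh-∷ m S (λ _ → 1) ⟩
    ∑[ x ∈ allFin n ] (𝟙 (x ∉? S) * ∑[ r ∈ allVecs m ] (𝟙 (fresh? (x ∷ S) r) * 1))
      ≡⟨ ∑-cong (allFin n) (λ x → 𝟙-*-cong (x ∉? S) tail) ⟩
    ∑[ x ∈ allFin n ] (𝟙 (x ∉? S) * m !)
      ≡⟨ ∑-*ʳ (allFin n) _ (m !) ⟩
    ∑[ x ∈ allFin n ] 𝟙 (x ∉? S) * m !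
      ≡⟨ cong (_* m !) (∑-∉-allFin u len) ⟩
    suc m * m ! ∎
    where
    open ≡-Reasoning
    tail : x ∉ S → ∑[ r ∈ allVecs m ] (𝟙 (fresh? (x ∷ S) r) * 1) ≡ m !
    tail {x} x∉S = trans (∑-cong (allVecs m) (λ r → ℕ.*-identityʳ (𝟙 (fresh? (x ∷ S) r))))
                         (count-fresh m (unique-∷ x∉S u) (length-∷-+ S m len))

  count-fresh-at : ∀ m (p : Fin (suc m)) c → Unique S → length S + suc m ≡ n →
    ∑[ r ∈ allVecs (suc m) ] (𝟙 (fresh? S r) * 𝟙 (lookup r p ≟ c)) ≡ 𝟙 (c ∉? S) * m !
  count-fresh-at {S} m Fin.zero c u len = begin
    ∑[ r ∈ allVecs (suc m) ] (𝟙 (fresh? S r) * 𝟙 (lookup r Fin.zero ≟ c))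
      ≡⟨ ∑-fresh-∷ m S (λ r → 𝟙 (lookup r Fin.zero ≟ c)) ⟩
    ∑[ x ∈ allFin n ] (𝟙 (x ∉? S) * ∑[ r ∈ allVecs m ] (𝟙 (fresh? (x ∷ S) r) * 𝟙 (x ≟ c)))
      ≡⟨ ∑-cong (allFin n) (λ x → 𝟙-*-cong (x ∉? S) tail) ⟩
    ∑[ x ∈ allFin n ] (𝟙 (x ∉? S) * (m ! * 𝟙 (x ≟ c)))
      ≡⟨ ∑-cong (allFin n) (λ x → rotate (𝟙 (x ∉? S)) (m !) (𝟙 (x ≟ c))) ⟩
    ∑[ x ∈ allFin n ] (𝟙 (x ≟ c) * (𝟙 (x ∉? S) * m !))
      ≡⟨ ∑-pick (allFin⁺ n) (∈-allFin c) (λ x → 𝟙 (x ∉? S) * m !) ⟩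
    𝟙 (c ∉? S) * m ! ∎
    where
    open ≡-Reasoning
    rotate : ∀ a b d → a * (b * d) ≡ d * (a * b)
    rotate a b d = trans (sym (ℕ.*-assoc a b d)) (ℕ.*-comm (a * b) d)
    tail : x ∉ S → ∑[ r ∈ allVecs m ] (𝟙 (fresh? (x ∷ S) r) * 𝟙 (x ≟ c)) ≡ m ! * 𝟙 (x ≟ c)
    tail {x} x∉S = trans (∑-*ʳ (allVecs m) _ (𝟙 (x ≟ c)))
                         (cong (_* 𝟙 (x ≟ c)) (count-fresh m (unique-∷ x∉S u) (length-∷-+ S m len)))
  count-fresh-at {S} (suc m) (Fin.suc p) c u len = begin
    ∑[ r ∈ allVecs (suc (suc m)) ] (𝟙 (fresh? S r) * 𝟙 (lookup r (Fin.suc p) ≟ c))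
      ≡⟨ ∑-fresh-∷ (suc m) S (λ r → 𝟙 (lookup r (Fin.suc p) ≟ c)) ⟩
    ∑[ x ∈ allFin n ] (𝟙 (x ∉? S) * ∑[ r ∈ allVecs (suc m) ] (𝟙 (fresh? (x ∷ S) r) * 𝟙 (lookup r p ≟ c)))
      ≡⟨ ∑-cong (allFin n) (λ x → 𝟙-*-cong (x ∉? S) λ x∉S →
           count-fresh-at m p c (unique-∷ x∉S u) (length-∷-+ S (suc m) len)) ⟩
    ∑[ x ∈ allFin n ] (𝟙 (x ∉? S) * (𝟙 (c ∉? x ∷ S) * m !))
      ≡⟨ ∑-cong (allFin n) swap ⟩
    ∑[ x ∈ allFin n ] (𝟙 (c ∉? S) * (𝟙 (x ∉? c ∷ S) * m !))
      ≡⟨ ∑-*ˡ (allFin n) (𝟙 (c ∉? S)) _ ⟩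
    𝟙 (c ∉? S) * ∑[ x ∈ allFin n ] (𝟙 (x ∉? c ∷ S) * m !)
      ≡⟨ 𝟙-*-cong (c ∉? S) (λ c∉S → trans (∑-*ʳ (allFin n) _ (m !))
           (cong (_* m !) (∑-∉-allFin (unique-∷ c∉S u) (length-∷-+ S (suc m) len)))) ⟩
    𝟙 (c ∉? S) * (suc m * m !) ∎
    where
    open ≡-Reasoning
    swap : ∀ x → 𝟙 (x ∉? S) * (𝟙 (c ∉? x ∷ S) * m !) ≡ 𝟙 (c ∉? S) * (𝟙 (x ∉? c ∷ S) * m !)
    swap x = begin
      𝟙 (x ∉? S) * (𝟙 (c ∉? x ∷ S) * m !) ≡⟨ ℕ.*-assoc (𝟙 (x ∉? S)) _ _ ⟨
      𝟙 (x ∉? S) * 𝟙 (c ∉? x ∷ S) * m !   ≡⟨ cong (_* m !) (𝟙-∉-∷-swap x c S) ⟩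
      𝟙 (c ∉? S) * 𝟙 (x ∉? c ∷ S) * m !   ≡⟨ ℕ.*-assoc (𝟙 (c ∉? S)) _ _ ⟩
      𝟙 (c ∉? S) * (𝟙 (x ∉? c ∷ S) * m !) ∎

injective⇒surjective : ∀ {n} {f : Fin n → Fin n} → Injective _≡_ _≡_ f → StrictlySurjective _≡_ f
injective⇒surjective {suc m} {f} injective k with any? (λ i → f i ≟ k)
... | yes hit  = hit
... | no  miss = ⊥-elim (<⇒notInjective {f = f′} (ℕ.n<1+n m) (λ eq → injective (punchOut-injective {i = k} _ _ eq)))
  where
  f′ : Fin (suc m) → Fin m
  f′ i = Fin.punchOut {i = k} {j = f i} (λ eq → miss (i , sym eq))

IsPerm⇔Fresh : ∀ {n} (ν : Map n) → IsPerm ν ⇔ Fresh [] ν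
IsPerm⇔Fresh ν = mk⇔
  (λ (injective , _) → avoiding×injective⇒Fresh ν (λ _ ()) (injective _ _))
  (λ fresh → let injective = proj₂ (Fresh⇒avoiding×injective ν fresh) in
             (λ _ _ → injective) , injective⇒surjective injective)

∑-Sym : ∀ {n} (g : Map n → ℕ) → ∑ (Sym n) g ≡ ∑[ ν ∈ allVecs n ] (𝟙 (fresh? [] ν) * g ν)
∑-Sym {n} g = trans (∑-filter isPerm? (allVecs n) g) (∑-cong (allVecs n) λ ν →
  cong (_* g ν) (𝟙-cong (isPerm? ν) (fresh? [] ν) (Equivalence.to (IsPerm⇔Fresh ν)) (Equivalence.from (IsPerm⇔Fresh ν))))

length-Sym : ∀ n → length (Sym n) ≡ n !
length-Sym n = begin
  length (Sym n)                           ≡⟨ ℕ.*-identityʳ _ ⟨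
  length (Sym n) * 1                       ≡⟨ ∑-const (Sym n) 1 ⟨
  ∑[ _ ∈ Sym n ] 1                         ≡⟨ ∑-Sym {n} (λ _ → 1) ⟩
  ∑[ ν ∈ allVecs n ] (𝟙 (fresh? [] ν) * 1) ≡⟨ ∑-cong (allVecs n) (λ ν → ℕ.*-identityʳ (𝟙 (fresh? [] ν))) ⟩
  ∑[ ν ∈ allVecs n ] 𝟙 (fresh? [] ν)       ≡⟨ count-fresh n [] refl ⟩
  n !                                      ∎
  where open ≡-Reasoning

∑-Sym-fixing : ∀ n (i : Fin (suc n)) → ∑[ ν ∈ Sym (suc n) ] 𝟙 (lookup ν i ≟ i) ≡ n !
∑-Sym-fixing n i = trans (∑-Sym (λ ν → 𝟙 (lookup ν i ≟ i)))
                         (trans (count-fresh-at n i i [] refl) (ℕ.+-identityʳ (n !)))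

F≤n : ∀ {n} (ν : Map n) → F ν ≤ n
F≤n {n} ν = ℕ.≤-trans (List.length-filter (λ i → lookup ν i ≟ i) (allFin n)) (ℕ.≤-reflexive (length-allFin n))

F≡n : ∀ {n} (ν : Map n) → (∀ i → lookup ν i ≡ i) → F ν ≡ n
F≡n {n} ν fixed =
  trans (cong length (List.filter-all (λ i → lookup ν i ≟ i) {allFin n} (All.tabulate λ {i} _ → fixed i))) (length-allFin n)

∑-Sym-F : ∀ n → ∑ (Sym (suc n)) F ≡ suc n !
∑-Sym-F n = begin
  ∑ (Sym (suc n)) F
    ≡⟨ ∑-cong (Sym (suc n)) (λ ν → countD≡∑𝟙 (λ i → lookup ν i ≟ i) (allFin (suc n))) ⟩
  ∑[ ν ∈ Sym (suc n) ] ∑[ i ∈ allFin (suc n) ] 𝟙 (lookup ν i ≟ i)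
    ≡⟨ ∑-comm (Sym (suc n)) (allFin (suc n)) _ ⟩
  ∑[ i ∈ allFin (suc n) ] ∑[ ν ∈ Sym (suc n) ] 𝟙 (lookup ν i ≟ i)
    ≡⟨ ∑-cong (allFin (suc n)) (∑-Sym-fixing n) ⟩
  ∑[ _ ∈ allFin (suc n) ] (n !)
    ≡⟨ ∑-const (allFin (suc n)) (n !) ⟩
  length (allFin (suc n)) * n !
    ≡⟨ cong (_* n !) (length-allFin (suc n)) ⟩
  suc n ! ∎
  where open ≡-Reasoning

∑-Sym-moved : ∀ n → ∑[ ν ∈ Sym (suc n) ] (suc n ∸ F ν) ≡ n * suc n !
∑-Sym-moved n = ℕ.+-cancelʳ-≡ _ _ _ (begin
  ∑[ ν ∈ Sym (suc n) ] (suc n ∸ F ν) + suc n !            ≡⟨ cong (moved +_) (∑-Sym-F n) ⟨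
  ∑[ ν ∈ Sym (suc n) ] (suc n ∸ F ν) + ∑ (Sym (suc n)) F ≡⟨ ∑-∸ (Sym (suc n)) (suc n) F F≤n ⟩
  length (Sym (suc n)) * suc n                            ≡⟨ cong (_* suc n) (length-Sym (suc n)) ⟩
  suc n ! * suc n                                         ≡⟨ ℕ.*-comm (suc n !) (suc n) ⟩
  suc n * suc n !                                         ≡⟨ ℕ.+-comm (suc n !) (n * suc n !) ⟩
  n * suc n ! + suc n !                                   ∎)
  where
  open ≡-Reasoning
  moved : ℕ
  moved = ∑[ ν ∈ Sym (suc n) ] (suc n ∸ F ν)

∑-v*j : ∀ n → ∑[ j ∈ upTo (suc n) ] (v n j * j) ≡ ∑[ ν ∈ Sym n ] (n ∸ F ν)
∑-v*j n = trans (∑-cong-All (All.tabulate λ {j} j∈ → cong (_* j) (v≡ (ℕ.s≤s⁻¹ (∈-upTo⁻ j∈)))))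
                (∑-by-value n (Sym n) (λ ν → n ∸ F ν) (λ ν → ℕ.m∸n≤m n (F ν)))
  where
  v≡ : ∀ {j} → j ≤ n → v n j ≡ countD (λ ν → n ∸ F ν ℕ.≟ j) (Sym n)
  v≡ {j} j≤n = cong length (List.filter-≐ _ _ ((λ {ν} → to {ν}) , (λ {ν} → from {ν})) (Sym n))
    where
    to : ∀ {ν : Map n} → F ν ≡ n ∸ j → n ∸ F ν ≡ j
    to eq = trans (cong (n ∸_) eq) (ℕ.m∸[m∸n]≡n j≤n)
    from : ∀ {ν : Map n} → n ∸ F ν ≡ j → F ν ≡ n ∸ j
    from {ν} eq = trans (sym (ℕ.m∸[m∸n]≡n (F≤n ν))) (cong (n ∸_) eq)

lookup-∘ₘ : ∀ {n} (σ θ : Map n) i → lookup (σ ∘ₘ θ) i ≡ lookup σ (lookup θ i)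
lookup-∘ₘ σ θ = Vec.lookup∘tabulate (λ i → lookup σ (lookup θ i))

-- The entries of inv θ are computed by a function local to its definition; unification
-- recovers that function from inv θ ≡ tabulate _, exposing the search it performs.
lookup-≡tabulate : ∀ {n} {f : Fin n → Fin n} {v : Vec (Fin n) n} → v ≡ Vec.tabulate f → ∀ i → lookup v i ≡ f i
lookup-≡tabulate refl = Vec.lookup∘tabulate _

inv-inverseʳ : ∀ {n} (θ : Map n) → IsPerm θ → ∀ i → lookup θ (lookup (inv θ) i) ≡ i
inv-inverseʳ θ (_ , surjective) i rewrite lookup-≡tabulate {v = inv θ} refl i
  with any? (λ k → lookup θ k ≟ i)
... | yes (_ , θk≡i) = θk≡i
... | no  miss       = ⊥-elim (miss (surjective i))

inv-unique : ∀ {n} (θ : Map n) {i k} → IsPerm θ → lookup θ k ≡ i → lookup (inv θ) i ≡ k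
inv-unique θ {i} perm θk≡i = proj₁ perm _ _ (trans (inv-inverseʳ θ perm i) (sym θk≡i))

dS-refl : ∀ {n} (σ : Map n) → IsPerm σ → dS σ σ ≡ 0
dS-refl {n} σ perm = trans (cong (n ∸_) (F≡n (σ ∘ₘ inv σ) fixed)) (ℕ.n∸n≡0 n)
  where
  fixed : ∀ i → lookup (σ ∘ₘ inv σ) i ≡ i
  fixed i = trans (lookup-∘ₘ σ (inv σ) i) (inv-inverseʳ σ perm i)

fixed-∘ₘ-inv : ∀ {n} (σ θ : Map n) {i} → IsPerm σ → IsPerm θ →
               lookup (σ ∘ₘ inv θ) i ≡ i → lookup (θ ∘ₘ inv σ) i ≡ i
fixed-∘ₘ-inv σ θ {i} permσ permθ fixed = begin
  lookup (θ ∘ₘ inv σ) i       ≡⟨ lookup-∘ₘ θ (inv σ) i ⟩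
  lookup θ (lookup (inv σ) i) ≡⟨ cong (lookup θ) (inv-unique σ permσ (trans (sym (lookup-∘ₘ σ (inv θ) i)) fixed)) ⟩
  lookup θ (lookup (inv θ) i) ≡⟨ inv-inverseʳ θ permθ i ⟩
  i                           ∎
  where open ≡-Reasoning

dS-sym : ∀ {n} (σ θ : Map n) → IsPerm σ → IsPerm θ → dS σ θ ≡ dS θ σ
dS-sym {n} σ θ permσ permθ = cong (λ xs → n ∸ length xs)
  (List.filter-≐ _ _ (fixed-∘ₘ-inv σ θ permσ permθ , fixed-∘ₘ-inv θ σ permθ permσ) (allFin n))

AllPairs-dS-sym : ∀ {n c} {D : List (Map n)} → All IsPerm D → AllPairs (λ σ θ → dS σ θ ≡ c) D →
                  AllPairs (λ σ θ → dS σ θ ≡ c × dS θ σ ≡ c) D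
AllPairs-dS-sym []                   []           = []
AllPairs-dS-sym {D = σ ∷ _} (p ∷ ps) (row ∷ rest) =
  All.zipWith (λ {θ} (q , e) → e , trans (dS-sym θ σ q p) e) (ps , row) ∷ AllPairs-dS-sym ps rest

-- ℤ's prefix +_ is opened only here: elsewhere it would make sections such as (x +_) ambiguous.
module _ where

  open import Data.Integer using (+_)

  private
    toℚᵘ-/ : ∀ a d → ℚ.toℚᵘ (+ a / suc d) ℚᵘ.≃ mkℚᵘ (+ a) d
    toℚᵘ-/ a d = ℚ.toℚᵘ-fromℚᵘ (mkℚᵘ (+ a) d)

    mkℚᵘ-≃ : ∀ {x y d e} → x * suc e ≡ y * suc d → mkℚᵘ (+ x) d ℚᵘ.≃ mkℚᵘ (+ y) e
    mkℚᵘ-≃ {x} {y} {d} {e} eq = *≡* (trans (sym (ℤ.pos-* x (suc e))) (trans (cong +_ eq) (ℤ.pos-* y (suc d))))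

    pos-*-distribʳ-+ : ∀ a b N → + a ℤ.* + N ℤ.+ + b ℤ.* + N ≡ + ((a + b) * N)
    pos-*-distribʳ-+ a b N = begin
      + a ℤ.* + N ℤ.+ + b ℤ.* + N ≡⟨ cong₂ ℤ._+_ (ℤ.pos-* a N) (ℤ.pos-* b N) ⟨
      + (a * N) ℤ.+ + (b * N)     ≡⟨ ℤ.pos-+ (a * N) (b * N) ⟨
      + (a * N + b * N)           ≡⟨ cong +_ (ℕ.*-distribʳ-+ N a b) ⟨
      + ((a + b) * N)             ∎
      where open ≡-Reasoning

  /-≡ : ∀ {x y d e} → x * suc e ≡ y * suc d → + x / suc d ≡ + y / suc e
  /-≡ {x} {y} {d} {e} eq = ℚ.fromℚᵘ-cong {mkℚᵘ (+ x) d} {mkℚᵘ (+ y) e} (mkℚᵘ-≃ eq)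

  /-+ : ∀ a b N .{{_ : NonZero N}} → + a / N ℚ.+ + b / N ≡ + (a + b) / N
  /-+ a b N@(suc d) = ℚ.toℚᵘ-injective (begin
    ℚ.toℚᵘ (+ a / N ℚ.+ + b / N)           ≈⟨ ℚ.toℚᵘ-homo-+ (+ a / N) (+ b / N) ⟩
    ℚ.toℚᵘ (+ a / N) ℚᵘ.+ ℚ.toℚᵘ (+ b / N) ≈⟨ ℚᵘ.+-cong (toℚᵘ-/ a d) (toℚᵘ-/ b d) ⟩
    mkℚᵘ (+ a) d ℚᵘ.+ mkℚᵘ (+ b) d         ≡⟨ cong (λ z → mkℚᵘ z (d + d * N)) (pos-*-distribʳ-+ a b N) ⟩
    mkℚᵘ (+ ((a + b) * N)) (d + d * N)     ≈⟨ mkℚᵘ-≃ (ℕ.*-assoc (a + b) N N) ⟩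
    mkℚᵘ (+ (a + b)) d                     ≈⟨ toℚᵘ-/ (a + b) d ⟨
    ℚ.toℚᵘ (+ (a + b) / N)                 ∎)
    where open import Relation.Binary.Reasoning.Setoid ℚᵘ.≃-setoid

  /-*-toℚ : ∀ a c N .{{_ : NonZero N}} → (+ a / N) ℚ.* toℚ c ≡ + (a * c) / N
  /-*-toℚ a c N@(suc d) = ℚ.toℚᵘ-injective (begin
    ℚ.toℚᵘ (+ a / N ℚ.* toℚ c)           ≈⟨ ℚ.toℚᵘ-homo-* (+ a / N) (toℚ c) ⟩
    ℚ.toℚᵘ (+ a / N) ℚᵘ.* ℚ.toℚᵘ (toℚ c) ≈⟨ ℚᵘ.*-cong (toℚᵘ-/ a d) (toℚᵘ-/ c 0) ⟩
    mkℚᵘ (+ a) d ℚᵘ.* mkℚᵘ (+ c) 0        ≡⟨ cong (λ z → mkℚᵘ z (d * 1)) (ℤ.pos-* a c) ⟨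
    mkℚᵘ (+ (a * c)) (d * 1)              ≈⟨ mkℚᵘ-≃ (cong (λ k → a * c * suc k) (sym (ℕ.*-identityʳ d))) ⟩
    mkℚᵘ (+ (a * c)) d                    ≈⟨ toℚᵘ-/ (a * c) d ⟨
    ℚ.toℚᵘ (+ (a * c) / N)                ∎)
    where open import Relation.Binary.Reasoning.Setoid ℚᵘ.≃-setoid

  *-/-cancelʳ : ∀ k N .{{_ : NonZero N}} → + (k * N) / N ≡ toℚ k
  *-/-cancelʳ k (suc d) = /-≡ {k * suc d} {k} {d} {0} (ℕ.*-identityʳ (k * suc d))

  Σℚ-cong : ∀ n {f g : ℕ → ℚ} → (∀ j → f j ≡ g j) → Σℚ n f ≡ Σℚ n g
  Σℚ-cong n eq = List.foldr-cong (λ j s → cong (ℚ._+ s) (eq j)) refl (upTo (suc n))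

  Σℚ-/ : ∀ n (g : ℕ → ℚ) (h : ℕ → ℕ) N .{{_ : NonZero N}} → (∀ j → g j ≡ + h j / N) →
         Σℚ n g ≡ + ∑[ j ∈ upTo (suc n) ] h j / N
  Σℚ-/ n g h N@(suc d) g≡h/N = go (upTo (suc n))
    where
    go : ∀ js → foldr (λ j s → g j ℚ.+ s) 0ℚ js ≡ + ∑ js h / N
    go []       = /-≡ {0} {0} {0} {d} refl
    go (j ∷ js) = trans (cong₂ ℚ._+_ (g≡h/N j) (go js)) (/-+ (h j) (∑ js h) N)

  IsDesign-1⇔ : ∀ n (D : List (Map n)) →
    IsDesign n 1 D ⇔ (Σℚ n (λ j → toℚ j ℚ.* freq D j) ≡ Σℚ n (λ j → _/_ (+ v n j) (n !) {{n ℕ.!≢0}} ℚ.* toℚ (j ^ 1)))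
  IsDesign-1⇔ n D = mk⇔ (λ design → trans commute (design 1 ℕ.≤-refl ℕ.≤-refl)) from
    where
    commute : Σℚ n (λ j → toℚ j ℚ.* freq D j) ≡ Σℚ n (λ j → freq D j ℚ.* toℚ (j ^ 1))
    commute = Σℚ-cong n λ j →
      trans (ℚ.*-comm (toℚ j) (freq D j)) (cong (λ k → freq D j ℚ.* toℚ k) (sym (ℕ.*-identityʳ j)))
    from : Σℚ n (λ j → toℚ j ℚ.* freq D j) ≡ Σℚ n (λ j → _/_ (+ v n j) (n !) {{n ℕ.!≢0}} ℚ.* toℚ (j ^ 1)) →
           IsDesign n 1 D
    from moment (suc zero)    _ _        = trans (sym commute) moment
    from moment (suc (suc _)) _ (s≤s ())

  uniform-first-moment : ∀ n →
    Σℚ (suc n) (λ j → _/_ (+ v (suc n) j) (suc n !) {{suc n ℕ.!≢0}} ℚ.* toℚ (j ^ 1)) ≡ toℚ n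
  uniform-first-moment n = begin
    Σℚ (suc n) (λ j → (+ v (suc n) j / suc n !) ℚ.* toℚ (j ^ 1))
      ≡⟨ Σℚ-/ (suc n) _ (λ j → v (suc n) j * j) (suc n !) term ⟩
    + ∑[ j ∈ upTo (suc (suc n)) ] (v (suc n) j * j) / suc n !
      ≡⟨ cong (λ k → + k / suc n !) (trans (∑-v*j (suc n)) (∑-Sym-moved n)) ⟩
    + (n * suc n !) / suc n !
      ≡⟨ *-/-cancelʳ n (suc n !) ⟩
    toℚ n ∎
    where
    open ≡-Reasoning
    instance
      N!≢0 : NonZero (suc n !)
      N!≢0 = suc n ℕ.!≢0
    term : ∀ j → (+ v (suc n) j / suc n !) ℚ.* toℚ (j ^ 1) ≡ + (v (suc n) j * j) / suc n !
    term j = trans (/-*-toℚ (v (suc n) j) (j ^ 1) (suc n !))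
                   (cong (λ k → + (v (suc n) j * k) / suc n !) (ℕ.*-identityʳ j))

  Σℚ-first-moment-freq : ∀ {n} (σ : Map n) (D : List (Map n)) → let m = suc (length D) in
    Σℚ n (λ j → toℚ j ℚ.* freq (σ ∷ D) j) ≡ + ∑[ x ∈ σ ∷ D ] ∑[ y ∈ σ ∷ D ] dS x y / (m * m)
  Σℚ-first-moment-freq {n} σ D = begin
    Σℚ n (λ j → toℚ j ℚ.* freq (σ ∷ D) j)
      ≡⟨ Σℚ-/ n _ (λ j → pairCount (σ ∷ D) j * j) (m * m) (λ j →
           trans (ℚ.*-comm (toℚ j) (freq (σ ∷ D) j)) (/-*-toℚ (pairCount (σ ∷ D) j) j (m * m))) ⟩
    + ∑[ j ∈ upTo (suc n) ] (pairCount (σ ∷ D) j * j) / (m * m)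
      ≡⟨ cong (λ k → + k / (m * m)) (trans (∑-by-value n pairs distance (λ (x , y) → ℕ.m∸n≤m n (F (x ∘ₘ inv y))))
                                            (∑-cartesianProduct (σ ∷ D) (σ ∷ D) distance)) ⟩
    + ∑[ x ∈ σ ∷ D ] ∑[ y ∈ σ ∷ D ] dS x y / (m * m) ∎
    where
    open ≡-Reasoning
    m : ℕ
    m = suc (length D)
    pairs : List (Map n × Map n)
    pairs = cartesianProduct (σ ∷ D) (σ ∷ D)
    distance : Map n × Map n → ℕ
    distance (x , y) = dS x y

  first-moment-antipodal : ∀ n (D : List (Map (suc n))) → length D ≡ suc n → All IsPerm D →
    AllPairs (λ σ θ → dS σ θ ≡ suc n) D → Σℚ (suc n) (λ j → toℚ j ℚ.* freq D j) ≡ toℚ n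
  first-moment-antipodal n (σ ∷ D) len perms antipodal = begin
    Σℚ (suc n) (λ j → toℚ j ℚ.* freq (σ ∷ D) j) ≡⟨ Σℚ-first-moment-freq σ D ⟩
    + T / (m * m)                              ≡⟨ cong (λ k → + k / (m * m)) total ⟩
    + (n * (m * m)) / (m * m)                  ≡⟨ *-/-cancelʳ n (m * m) ⟩
    toℚ n                                      ∎
    where
    open ≡-Reasoning
    m T : ℕ
    m = suc (length D)
    T = ∑[ x ∈ σ ∷ D ] ∑[ y ∈ σ ∷ D ] dS x y
    total : T ≡ n * (m * m)
    total = ℕ.+-cancelʳ-≡ _ _ _ (begin
      T + m * m           ≡⟨ cong (λ k → T + m * k) len ⟩
      T + m * suc n       ≡⟨ ∑∑-const-off-diagonal dS (suc n) (σ ∷ D) (All.map (λ {τ} → dS-refl τ) perms)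
                                                   (AllPairs-dS-sym perms antipodal) ⟩
      m * m * suc n       ≡⟨ ℕ.*-suc (m * m) n ⟩
      m * m + m * m * n   ≡⟨ ℕ.+-comm (m * m) _ ⟩
      m * m * n + m * m   ≡⟨ cong (_+ m * m) (ℕ.*-comm (m * m) n) ⟩
      n * (m * m) + m * m ∎)

theorem3 : (n : ℕ) → 1 ≤ n → (D : List (Map n)) → All IsPerm D → Unique D → D ≢ [] →
    (IsDesign n 1 D ⇔ (Σℚ n (λ j → toℚ j ℚ.* freq D j) ≡ toℚ (n ∸ 1)))
    × (length D ≡ n → AllPairs (λ x y → dS x y ≡ n) D → IsDesign n 1 D)
theorem3 (suc n) _ D perms _ _ =
  first-moment⇔ , λ len antipodal → Equivalence.from first-moment⇔ (first-moment-antipodal n D len perms antipodal)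
  where
  first-moment⇔ : IsDesign (suc n) 1 D ⇔ (Σℚ (suc n) (λ j → toℚ j ℚ.* freq D j) ≡ toℚ n)
  first-moment⇔ = subst (λ μ → IsDesign (suc n) 1 D ⇔ (Σℚ (suc n) (λ j → toℚ j ℚ.* freq D j) ≡ μ))
                        (uniform-first-moment n) (IsDesign-1⇔ (suc n) D)
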